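{- For every $n\ge 1$, $|\mathcal{DRS}_n(231)|=|\mathcal{DRS}_n(312)|=|\mathcal{RS}_n(312)|=2^{n-1}$.
   Context: For $\sigma\in\mathfrak{S}_n$, a double descent is an index $i$ with $\sigma_i>\sigma_{i+1}>\sigma_{i+2}$. The permutation $\sigma$ is simsun if for every $k$, the subword of $\sigma$ consisting of the letters in $\{1,\dots,k\}$ (in the order they appear in $\sigma$) has no double descent. For $\omega\in\mathfrak{S}_t$, $\sigma$ contains an $\omega$-pattern if there are indices $i_1<\cdots<i_t$ with $\sigma_{i_j}<\sigma_{i_k}$ iff $\omega_j<\omega_k$; otherwise $\sigma$ avoids $\omega$. $\mathcal{RS}_n(\omega)$ is the set of $\omega$-avoiding simsun permutations in $\mathfrak{S}_n$, and $\mathcal{DRS}_n(\omega)$ is the set of $\sigma\in\mathcal{RS}_n(\omega)$ such that $\sigma^{ -1}$ is simsun. -}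

module Defs where

open import Data.Bool using (Bool; true; false; _∧_; _∨_; not; if_then_else_)
open import Data.Nat using (ℕ; zero; suc; _+_; _∸_; _^_; _≡ᵇ_; _<ᵇ_)
open import Data.List using (List; []; _∷_; map; filterᵇ; length; concatMap; upTo; allFin; lookup; applyUpTo)
open import Data.Fin using (Fin; toℕ)
open import Data.Bool.ListAction using (and; or)

-- Permutations of [n] = {1,…,n} are represented in one-line notation as
-- lists of natural numbers σ = σ₁ σ₂ … σₙ (entries 1..n, each exactly once).

range1 : ℕ → List ℕ
range1 n = applyUpTo suc n

elem : ℕ → List ℕ → Bool
elem x []       = false
elem x (y ∷ ys) = (x ≡ᵇ y) ∨ elem x ys

distinct : List ℕ → Bool
distinct []       = true
distinct (x ∷ xs) = not (elem x xs) ∧ distinct xs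

words : ℕ → ℕ → List (List ℕ)
words n zero    = [] ∷ []
words n (suc k) = concatMap (λ a → map (a ∷_) (words n k)) (range1 n)

Sym : ℕ → List (List ℕ)
Sym n = filterᵇ distinct (words n n)

hasDoubleDescent : List ℕ → Bool
hasDoubleDescent (a ∷ b ∷ c ∷ rest) =
  ((b <ᵇ a) ∧ (c <ᵇ b)) ∨ hasDoubleDescent (b ∷ c ∷ rest)
hasDoubleDescent _ = false

restrictTo : ℕ → List ℕ → List ℕ
restrictTo k = filterᵇ (λ x → x <ᵇ suc k)

-- σ ∈ 𝔖ₙ is simsun: for every k (1 ≤ k ≤ n; for k ≥ n the subword is σ
-- itself and for k = 0 it is empty) the restriction has no double descent
isSimsun : ℕ → List ℕ → Bool
isSimsun n σ = and (map (λ k → not (hasDoubleDescent (restrictTo k σ))) (range1 n))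

subseqs : List ℕ → List (List ℕ)
subseqs []       = [] ∷ []
subseqs (x ∷ xs) = let s = subseqs xs in map (x ∷_) s Data.List.++ s

orderIso : List ℕ → List ℕ → Bool
orderIso u w =
  (length u ≡ᵇ length w) ∧
  and (map (λ j → and (map (λ k →
       (lookup u j <ᵇ lookup u k) ≡B (lookupW j <ᵇ lookupW k)) (allFin (length u))))
       (allFin (length u)))
  where
  _≡B_ : Bool → Bool → Bool
  true  ≡B b = b
  false ≡B b = not b
  lookupW : Fin (length u) → ℕ
  lookupW j = nth (toℕ j) w
    where
    nth : ℕ → List ℕ → ℕ
    nth _       []       = 0
    nth zero    (x ∷ _)  = x
    nth (suc i) (_ ∷ xs) = nth i xs

contains : List ℕ → List ℕ → Bool
contains ω σ = or (map (orderIso ω) (subseqs σ))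
  -- orderIso ω s already forces length s = length ω

avoids : List ℕ → List ℕ → Bool
avoids ω σ = not (contains ω σ)

-- position (1-based) of value v in σ
position : ℕ → List ℕ → ℕ
position v []       = 0
position v (x ∷ xs) = if v ≡ᵇ x then 1 else suc (position v xs)

inverse : ℕ → List ℕ → List ℕ
inverse n σ = map (λ v → position v σ) (range1 n)

RS : ℕ → List ℕ → List (List ℕ)
RS n ω = filterᵇ (λ σ → isSimsun n σ ∧ avoids ω σ) (Sym n)

DRS : ℕ → List ℕ → List (List ℕ)
DRS n ω = filterᵇ (λ σ → isSimsun n (inverse n σ)) (RS n ω)

p231 p312 : List ℕ
p231 = 2 ∷ 3 ∷ 1 ∷ []
p312 = 3 ∷ 1 ∷ 2 ∷ []

module Submission where

-- Write σ ∈ RSₙ₊₁(312) as xs (n+1) ys.  Deleting n+1 keeps σ simsun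
-- (the restriction to [n] is simsun) and 312-free, and ys has at most one
-- letter: two letters y₁ y₂ after n+1 form a 312 if y₁ < y₂ and a double
-- descent if y₁ > y₂.  Conversely, inserting n+1 into one of the last two
-- slots of τ ∈ RSₙ(312) stays in RSₙ₊₁(312), so |RSₙ₊₁(312)| = 2|RSₙ(312)|.
-- The same decomposition shows by induction that RSₙ(312) avoids 321; as
-- inversion preserves 321-avoidance and 321-avoiding words are simsun,
-- DRSₙ(312) = RSₙ(312).  Finally σ contains 231 iff σ⁻¹ contains 312, so
-- inversion is a bijection DRSₙ(231) → DRSₙ(312).

open import Defs
open import Data.Nat using (ℕ; _≤_; _∸_; _^_)
open import Data.List using (length)
open import Data.Product using (_×_)
open import Relation.Binary.PropositionalEquality using (_≡_)

open import Data.Bool using (Bool; true; false; T; not; _∧_; _∨_)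
open import Data.Bool.Properties using (T-∧; T-∨)
open import Data.Empty using (⊥; ⊥-elim)
open import Data.List using (List; []; _∷_; _++_; map; filterᵇ; concatMap; applyUpTo; [_]; initLast; _∷ʳ′_)
import Data.List.Properties as LP
open import Data.List.Membership.Propositional using (_∈_; _∉_; find)
import Data.List.Membership.Propositional.Properties as MP
open import Data.List.Relation.Unary.All as All using (All; []; _∷_)
open import Data.List.Relation.Unary.All.Properties using (all⁺; all⁻; ++⁻ˡ)
open import Data.List.Relation.Unary.Any as Any using (Any; here; there)
open import Data.List.Relation.Unary.Any.Properties using (any⁺; any⁻)
open import Data.List.Relation.Binary.Sublist.Propositional.Properties using (filter-⊆; Any-resp-⊆; length-mono-≤; ++⁺; ++⁺ˡ)
open import Data.List.Relation.Binary.Sublist.Propositional using (_⊆_; []; _∷_; _∷ʳ_; ⊆-trans; ⊆-refl; minimum)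
open import Data.List.Relation.Unary.Unique.Propositional using (Unique; []; _∷_)
import Data.List.Relation.Unary.Unique.Propositional.Properties as UP
open import Data.List.Membership.Propositional.Properties.WithK using (unique∧set⇒bag)
open import Data.List.Relation.Binary.BagAndSetEquality using (∼bag⇒↭)
open import Data.List.Relation.Binary.Permutation.Propositional.Properties using (↭-length)
open import Data.Nat using (zero; suc; _<_; _*_; _<ᵇ_; _≡ᵇ_; z≤n; s≤s)
import Data.Nat.Properties as NP
open import Data.List.Membership.DecPropositional NP._≟_ using (_∈?_)
open import Data.Product using (∃; ∃₂; _,_; proj₁; proj₂; map₂)
open import Data.Sum using (_⊎_; inj₁; inj₂; map₁)
open import Function using (_∘_)
open import Function.Bundles using (Equivalence; mk⇔)
open import Relation.Binary.PropositionalEquality using (refl; sym; trans; cong; cong₂; subst; _≢_; module ≡-Reasoning)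
open import Relation.Nullary using (¬_; yes; no)
open import Relation.Binary.Definitions using (Tri; tri<; tri≈; tri>)
open import Relation.Nullary.Decidable using (T?)

T∧⁻ : ∀ a {b} → T (a ∧ b) → T a × T b
T∧⁻ a = Equivalence.to (T-∧ {a})

T∧⁺ : ∀ {a b} → T a → T b → T (a ∧ b)
T∧⁺ ta tb = Equivalence.from T-∧ (ta , tb)

T∨⁻ : ∀ a {b} → T (a ∨ b) → T a ⊎ T b
T∨⁻ a = Equivalence.to (T-∨ {a})

T∨ˡ : ∀ {a} b → T a → T (a ∨ b)
T∨ˡ b ta = Equivalence.from T-∨ (inj₁ ta)

T∨ʳ : ∀ a {b} → T b → T (a ∨ b)
T∨ʳ a tb = Equivalence.from (T-∨ {a}) (inj₂ tb)

T-not⁻ : ∀ {a} → T (not a) → ¬ T a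
T-not⁻ {false} _ ()

T-not⁺ : ∀ {a} → ¬ T a → T (not a)
T-not⁺ {true}  ¬t = ¬t _
T-not⁺ {false} _  = _

<ᵇ-true : ∀ {m n} → m < n → (m <ᵇ n) ≡ true
<ᵇ-true {m} {n} m<n with m <ᵇ n | NP.<⇒<ᵇ m<n
... | true | _ = refl

<ᵇ-false : ∀ {m n} → n ≤ m → (m <ᵇ n) ≡ false
<ᵇ-false {m} {n} n≤m with m <ᵇ n in eq
... | false = refl
... | true  = ⊥-elim (NP.≤⇒≯ n≤m (NP.<ᵇ⇒< m n (subst T (sym eq) _)))

∈-filterᵇ⁻ : ∀ {A : Set} (p : A → Bool) {x} xs → x ∈ filterᵇ p xs → x ∈ xs × T (p x)
∈-filterᵇ⁻ p xs = MP.∈-filter⁻ (T? ∘ p) {xs = xs}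

∈-filterᵇ⁺ : ∀ {A : Set} (p : A → Bool) {x} xs → x ∈ xs → T (p x) → x ∈ filterᵇ p xs
∈-filterᵇ⁺ p xs = MP.∈-filter⁺ (T? ∘ p) {xs = xs}

same-length : ∀ {A : Set} {xs ys : List A} → Unique xs → Unique ys →
  (∀ {z} → z ∈ xs → z ∈ ys) → (∀ {z} → z ∈ ys → z ∈ xs) → length xs ≡ length ys
same-length ux uy to from = ↭-length (∼bag⇒↭ (unique∧set⇒bag ux uy (mk⇔ to from)))

unique-concatMap : ∀ {A B : Set} (f : A → List B) (r : B → A) {xs : List A} → Unique xs →
  (∀ {x} → x ∈ xs → Unique (f x)) → (∀ {x z} → x ∈ xs → z ∈ f x → r z ≡ x) →
  Unique (concatMap f xs)
unique-concatMap f r {[]} [] _ _ = []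
unique-concatMap f r {x ∷ xs} (x∉xs ∷ u) uf ret =
  UP.++⁺ (uf (here refl)) (unique-concatMap f r u (uf ∘ there) (ret ∘ there)) disjoint
  where
  disjoint : ∀ {z} → z ∈ f x × z ∈ concatMap f xs → ⊥
  disjoint (z∈fx , z∈rest) with find (MP.∈-concatMap⁻ f {xs = xs} z∈rest)
  ... | y , y∈xs , z∈fy = All.lookup x∉xs y∈xs (trans (sym (ret (here refl) z∈fx)) (ret (there y∈xs) z∈fy))

unique-map-on : ∀ {A B : Set} (f : A → B) {xs : List A} → Unique xs →
  (∀ {x y} → x ∈ xs → y ∈ xs → f x ≡ f y → x ≡ y) → Unique (map f xs)
unique-map-on f {[]} [] _ = []
unique-map-on f {x ∷ xs} (x∉xs ∷ u) inj =
  All.tabulate fx∉ ∷ unique-map-on f u (λ p q → inj (there p) (there q))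
  where
  fx∉ : ∀ {z} → z ∈ map f xs → f x ≢ z
  fx∉ z∈ fx≡z with MP.∈-map⁻ f z∈
  ... | y , y∈xs , refl = All.lookup x∉xs y∈xs (inj (here refl) (there y∈xs) fx≡z)

length-middle : ∀ {A : Set} {x : A} us vs → length (us ++ x ∷ vs) ≡ suc (length (us ++ vs))
length-middle [] vs = refl
length-middle (u ∷ us) vs = cong suc (length-middle us vs)

unique⊆⇒length≤ : ∀ {A : Set} {xs ys : List A} → Unique xs →
  (∀ {z} → z ∈ xs → z ∈ ys) → length xs ≤ length ys
unique⊆⇒length≤ {xs = []} _ _ = z≤n
unique⊆⇒length≤ {xs = x ∷ xs} (x∉xs ∷ u) xs⊆ys with MP.∈-∃++ (xs⊆ys (here refl))
... | us , vs , refl = NP.≤-trans (s≤s (unique⊆⇒length≤ u xs⊆us++vs)) (NP.≤-reflexive (sym (length-middle us vs)))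
  where
  xs⊆us++vs : ∀ {z} → z ∈ xs → z ∈ us ++ vs
  xs⊆us++vs {z} z∈xs with MP.∈-++⁻ us (xs⊆ys (there z∈xs))
  ... | inj₁ z∈us = MP.∈-++⁺ˡ z∈us
  ... | inj₂ (here refl) = ⊥-elim (All.lookup x∉xs z∈xs refl)
  ... | inj₂ (there z∈vs) = MP.∈-++⁺ʳ us z∈vs

InRange : ℕ → ℕ → Set
InRange n v = 1 ≤ v × v ≤ n

record IsPerm (n : ℕ) (σ : List ℕ) : Set where
  constructor perm
  field
    length≡ : length σ ≡ n
    inRange : All (InRange n) σ
    unique  : Unique σ
open IsPerm

IsPerm⇒≤ : ∀ {n σ} → IsPerm n σ → All (_≤ n) σ
IsPerm⇒≤ p = All.map proj₂ (inRange p)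

range1-∈⁻ : ∀ {n v} → v ∈ range1 n → InRange n v
range1-∈⁻ v∈ with MP.∈-applyUpTo⁻ suc v∈
... | _ , i<n , refl = s≤s z≤n , i<n

range1-∈⁺ : ∀ {n v} → InRange n v → v ∈ range1 n
range1-∈⁺ {v = suc v} (_ , v<n) = MP.∈-applyUpTo⁺ suc v<n

range1-unique : ∀ n → Unique (range1 n)
range1-unique n = UP.applyUpTo⁺₁ suc n (λ i<j _ → NP.<⇒≢ i<j ∘ NP.suc-injective)

-- A permutation of [n] contains every letter of [n] (by pigeonhole).
perm-surjective : ∀ {n σ v} → IsPerm n σ → InRange n v → v ∈ σ
perm-surjective {n} {σ} {v} p v∈[n] with v ∈? σ
... | yes v∈σ = v∈σ
... | no v∉σ = ⊥-elim (NP.<-irrefl refl (NP.≤-trans too-long (NP.≤-reflexive lengths)))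
  where
  too-long : suc (length σ) ≤ length (range1 n)
  too-long = unique⊆⇒length≤ (All.tabulate (λ z∈σ v≡z → v∉σ (subst (_∈ σ) (sym v≡z) z∈σ)) ∷ unique p)
               λ { (here refl) → range1-∈⁺ v∈[n] ; (there z∈σ) → range1-∈⁺ (All.lookup (inRange p) z∈σ) }
  lengths : length (range1 n) ≡ length σ
  lengths = trans (LP.length-applyUpTo suc n) (sym (length≡ p))

elem⁻ : ∀ x xs → T (elem x xs) → x ∈ xs
elem⁻ x (y ∷ xs) t with T∨⁻ (x ≡ᵇ y) t
... | inj₁ x≡y = here (NP.≡ᵇ⇒≡ x y x≡y)
... | inj₂ x∈xs = there (elem⁻ x xs x∈xs)

elem⁺ : ∀ x xs → x ∈ xs → T (elem x xs)
elem⁺ x (y ∷ xs) (here refl) = T∨ˡ (elem x xs) (NP.≡⇒≡ᵇ x x refl)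
elem⁺ x (y ∷ xs) (there x∈xs) = T∨ʳ (x ≡ᵇ y) (elem⁺ x xs x∈xs)

distinct⁻ : ∀ xs → T (distinct xs) → Unique xs
distinct⁻ [] _ = []
distinct⁻ (x ∷ xs) t with T∧⁻ (not (elem x xs)) t
... | x∉xs , d = All.tabulate (λ y∈xs x≡y → T-not⁻ x∉xs (elem⁺ x xs (subst (_∈ xs) (sym x≡y) y∈xs)))
                 ∷ distinct⁻ xs d

distinct⁺ : ∀ xs → Unique xs → T (distinct xs)
distinct⁺ [] _ = _
distinct⁺ (x ∷ xs) (x∉xs ∷ u) =
  T∧⁺ (T-not⁺ (λ t → All.lookup x∉xs (elem⁻ x xs t) refl)) (distinct⁺ xs u)

words-∈⁻ : ∀ n k {w} → w ∈ words n k → length w ≡ k × All (InRange n) w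
words-∈⁻ n zero (here refl) = refl , []
words-∈⁻ n (suc k) w∈ with find (MP.∈-concatMap⁻ (λ a → map (a ∷_) (words n k)) {xs = range1 n} w∈)
... | a , a∈[n] , aw∈ with MP.∈-map⁻ (a ∷_) aw∈
...   | w , w∈ , refl = let len , rng = words-∈⁻ n k w∈ in cong suc len , range1-∈⁻ a∈[n] ∷ rng

words-∈⁺ : ∀ n k w → length w ≡ k → All (InRange n) w → w ∈ words n k
words-∈⁺ n zero [] refl [] = here refl
words-∈⁺ n (suc k) (a ∷ w) refl (a∈[n] ∷ rng) =
  MP.∈-concatMap⁺ (λ b → map (b ∷_) (words n k)) {xs = range1 n}
    (Any.map (λ { refl → MP.∈-map⁺ (a ∷_) (words-∈⁺ n k w refl rng) }) (range1-∈⁺ a∈[n]))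

words-unique : ∀ n k → Unique (words n k)
words-unique n zero = [] ∷ []
words-unique n (suc k) =
  unique-concatMap (λ a → map (a ∷_) (words n k)) head (range1-unique n)
    (λ _ → UP.map⁺ (proj₂ ∘ LP.∷-injective) (words-unique n k))
    (λ _ z∈ → head-of z∈)
  where
  head : List ℕ → ℕ
  head [] = 0
  head (x ∷ _) = x
  head-of : ∀ {a z} → z ∈ map (a ∷_) (words n k) → head z ≡ a
  head-of z∈ with MP.∈-map⁻ _ z∈
  ... | _ , _ , refl = refl

Sym-∈⁻ : ∀ n {σ} → σ ∈ Sym n → IsPerm n σ
Sym-∈⁻ n σ∈ with ∈-filterᵇ⁻ distinct (words n n) σ∈
... | w∈ , d with words-∈⁻ n n w∈
...   | len , rng = perm len rng (distinct⁻ _ d)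

Sym-∈⁺ : ∀ n {σ} → IsPerm n σ → σ ∈ Sym n
Sym-∈⁺ n {σ} (perm len rng u) = ∈-filterᵇ⁺ distinct (words n n) (words-∈⁺ n n σ len rng) (distinct⁺ σ u)

Sym-unique : ∀ n → Unique (Sym n)
Sym-unique n = UP.filter⁺ _ (words-unique n n)

∈-insert⁺ : ∀ {A : Set} {z m : A} xs {ys} → z ∈ xs ++ ys → z ∈ xs ++ m ∷ ys
∈-insert⁺ [] z∈ = there z∈
∈-insert⁺ (x ∷ xs) (here refl) = here refl
∈-insert⁺ (x ∷ xs) (there z∈) = there (∈-insert⁺ xs z∈)

∈-insert⁻ : ∀ {A : Set} {z m : A} xs {ys} → z ∈ xs ++ m ∷ ys → z ≡ m ⊎ z ∈ xs ++ ys
∈-insert⁻ [] (here z≡m) = inj₁ z≡m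
∈-insert⁻ [] (there z∈) = inj₂ z∈
∈-insert⁻ (x ∷ xs) (here refl) = inj₂ (here refl)
∈-insert⁻ (x ∷ xs) (there z∈) with ∈-insert⁻ xs z∈
... | inj₁ z≡m = inj₁ z≡m
... | inj₂ z∈′ = inj₂ (there z∈′)

∈-middle : ∀ {A : Set} {m : A} xs {ys} → m ∈ xs ++ m ∷ ys
∈-middle [] = here refl
∈-middle (_ ∷ xs) = there (∈-middle xs)

unique-delete : ∀ {A : Set} {m : A} xs {ys} → Unique (xs ++ m ∷ ys) → Unique (xs ++ ys) × m ∉ xs ++ ys
unique-delete [] (m∉ys ∷ u) = u , λ m∈ys → All.lookup m∉ys m∈ys refl
unique-delete (x ∷ xs) (x∉ ∷ u) with unique-delete xs u
... | u′ , m∉ = All.tabulate (All.lookup x∉ ∘ ∈-insert⁺ xs) ∷ u′ , m∉′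
  where
  m∉′ : _ ∉ x ∷ xs ++ _
  m∉′ (here refl) = All.lookup x∉ (∈-middle xs) refl
  m∉′ (there m∈) = m∉ m∈

unique-insert : ∀ {A : Set} {m : A} xs {ys} → Unique (xs ++ ys) → m ∉ xs ++ ys → Unique (xs ++ m ∷ ys)
unique-insert [] u m∉ = All.tabulate (λ z∈ m≡z → m∉ (subst (_∈ _) (sym m≡z) z∈)) ∷ u
unique-insert (x ∷ xs) (x∉ ∷ u) m∉ =
  All.tabulate x≢ ∷ unique-insert xs u (m∉ ∘ there)
  where
  x≢ : ∀ {z} → z ∈ xs ++ _ ∷ _ → x ≢ z
  x≢ z∈ x≡z with ∈-insert⁻ xs z∈
  ... | inj₁ refl = m∉ (here (sym x≡z))
  ... | inj₂ z∈′ = All.lookup x∉ z∈′ x≡z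

perm-split : ∀ {n σ} → IsPerm (suc n) σ → ∃₂ λ xs ys → σ ≡ xs ++ suc n ∷ ys
perm-split p with MP.∈-∃++ (perm-surjective p (s≤s z≤n , NP.≤-refl))
... | xs , ys , σ≡ = xs , ys , σ≡

perm-delete : ∀ {n} xs ys → IsPerm (suc n) (xs ++ suc n ∷ ys) → IsPerm n (xs ++ ys)
perm-delete {n} xs ys (perm len rng u) with unique-delete xs u
... | u′ , n+1∉ = perm (NP.suc-injective (trans (sym (length-middle xs ys)) len)) (All.tabulate in-range) u′
  where
  in-range : ∀ {z} → z ∈ xs ++ ys → InRange n z
  in-range z∈ with All.lookup rng (∈-insert⁺ xs z∈)
  ... | 1≤z , z≤n+1 with NP.m≤n⇒m<n∨m≡n z≤n+1
  ...   | inj₁ z<n+1 = 1≤z , NP.≤-pred z<n+1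
  ...   | inj₂ refl = ⊥-elim (n+1∉ z∈)

perm-insert : ∀ {n} xs ys → IsPerm n (xs ++ ys) → IsPerm (suc n) (xs ++ suc n ∷ ys)
perm-insert {n} xs ys (perm len rng u) =
  perm (trans (length-middle xs ys) (cong suc len)) (All.tabulate in-range)
       (unique-insert xs u (λ n+1∈ → NP.<-irrefl refl (proj₂ (All.lookup rng n+1∈))))
  where
  in-range : ∀ {z} → z ∈ xs ++ suc n ∷ ys → InRange (suc n) z
  in-range z∈ with ∈-insert⁻ xs z∈
  ... | inj₁ refl = s≤s z≤n , NP.≤-refl
  ... | inj₂ z∈′ = map₂ NP.m≤n⇒m≤1+n (All.lookup rng z∈′)

-- Pattern occurrences.  A pattern of length three is a relation R on the
-- values (a , b , c) of an increasing triple of positions; σ contains it when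
-- some subsequence a b c of σ satisfies R.

Pattern : Set₁
Pattern = ℕ → ℕ → ℕ → Set

Is312 Is231 Is321 : Pattern
Is312 a b c = b < c × c < a
Is231 a b c = c < a × a < b
Is321 a b c = b < a × c < b

Occurs : Pattern → List ℕ → Set
Occurs R σ = ∃ λ a → ∃ λ b → ∃ λ c → R a b c × (a ∷ b ∷ c ∷ []) ⊆ σ

Occurs-⊆ : ∀ {R σ τ} → σ ⊆ τ → Occurs R σ → Occurs R τ
Occurs-⊆ σ⊆τ (a , b , c , r , abc⊆σ) = a , b , c , r , ⊆-trans abc⊆σ σ⊆τ

subseqs-∈⁻ : ∀ σ {s} → s ∈ subseqs σ → s ⊆ σ
subseqs-∈⁻ [] (here refl) = []
subseqs-∈⁻ (x ∷ σ) s∈ with MP.∈-++⁻ (map (x ∷_) (subseqs σ)) s∈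
... | inj₂ s∈′ = x ∷ʳ subseqs-∈⁻ σ s∈′
... | inj₁ xs∈ with MP.∈-map⁻ (x ∷_) xs∈
...   | s′ , s′∈ , refl = refl ∷ subseqs-∈⁻ σ s′∈

subseqs-∈⁺ : ∀ σ {s} → s ⊆ σ → s ∈ subseqs σ
subseqs-∈⁺ [] [] = here refl
subseqs-∈⁺ (x ∷ σ) (.x ∷ʳ s⊆σ) = MP.∈-++⁺ʳ (map (x ∷_) (subseqs σ)) (subseqs-∈⁺ σ s⊆σ)
subseqs-∈⁺ (x ∷ σ) (refl ∷ s⊆σ) = MP.∈-++⁺ˡ (MP.∈-map⁺ (x ∷_) (subseqs-∈⁺ σ s⊆σ))

contains⁻ : ∀ ω σ → T (contains ω σ) → ∃ λ s → s ⊆ σ × T (orderIso ω s)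
contains⁻ ω σ t with find (any⁻ (orderIso ω) (subseqs σ) t)
... | s , s∈ , iso = s , subseqs-∈⁻ σ s∈ , iso

contains⁺ : ∀ ω σ {s} → s ⊆ σ → T (orderIso ω s) → T (contains ω σ)
contains⁺ ω σ s⊆σ iso = any⁺ (orderIso ω) (Any.map (λ { refl → iso }) (subseqs-∈⁺ σ s⊆σ))

-- Once the diagonal is evaluated, a decision tree on the six
-- off-diagonal comparisons shows that only the pattern's defining ones survive.

orderIso312⁻ : ∀ a b c → T (orderIso p312 (a ∷ b ∷ c ∷ [])) → T (b <ᵇ c) × T (c <ᵇ a)
orderIso312⁻ a b c
  rewrite <ᵇ-false (NP.≤-refl {a}) | <ᵇ-false (NP.≤-refl {b}) | <ᵇ-false (NP.≤-refl {c})
  with a <ᵇ b | a <ᵇ c | b <ᵇ a | b <ᵇ c | c <ᵇ a | c <ᵇ b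
... | true  | _     | _     | _     | _     | _     = λ ()
... | false | true  | _     | _     | _     | _     = λ ()
... | false | false | false | _     | _     | _     = λ ()
... | false | false | true  | false | _     | _     = λ ()
... | false | false | true  | true  | false | _     = λ ()
... | false | false | true  | true  | true  | true  = λ ()
... | false | false | true  | true  | true  | false = λ _ → _ , _

orderIso231⁻ : ∀ a b c → T (orderIso p231 (a ∷ b ∷ c ∷ [])) → T (c <ᵇ a) × T (a <ᵇ b)
orderIso231⁻ a b c
  rewrite <ᵇ-false (NP.≤-refl {a}) | <ᵇ-false (NP.≤-refl {b}) | <ᵇ-false (NP.≤-refl {c})
  with a <ᵇ b | a <ᵇ c | b <ᵇ a | b <ᵇ c | c <ᵇ a | c <ᵇ b
... | false | _     | _     | _     | _     | _     = λ ()
... | true  | true  | _     | _     | _     | _     = λ ()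
... | true  | false | true  | _     | _     | _     = λ ()
... | true  | false | false | true  | _     | _     = λ ()
... | true  | false | false | false | false | _     = λ ()
... | true  | false | false | false | true  | false = λ ()
... | true  | false | false | false | true  | true  = λ _ → _ , _

orderIso312⁺ : ∀ {a b c} → Is312 a b c → T (orderIso p312 (a ∷ b ∷ c ∷ []))
orderIso312⁺ {a} {b} {c} (b<c , c<a)
  rewrite <ᵇ-false (NP.≤-refl {a}) | <ᵇ-false (NP.≤-refl {b}) | <ᵇ-false (NP.≤-refl {c})
        | <ᵇ-false {a} {b} (NP.<⇒≤ (NP.<-trans b<c c<a)) | <ᵇ-true (NP.<-trans b<c c<a)
        | <ᵇ-false {a} {c} (NP.<⇒≤ c<a) | <ᵇ-true b<c | <ᵇ-true c<a | <ᵇ-false {c} {b} (NP.<⇒≤ b<c) = _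

orderIso231⁺ : ∀ {a b c} → Is231 a b c → T (orderIso p231 (a ∷ b ∷ c ∷ []))
orderIso231⁺ {a} {b} {c} (c<a , a<b)
  rewrite <ᵇ-false (NP.≤-refl {a}) | <ᵇ-false (NP.≤-refl {b}) | <ᵇ-false (NP.≤-refl {c})
        | <ᵇ-true a<b | <ᵇ-false {a} {c} (NP.<⇒≤ c<a) | <ᵇ-false {b} {a} (NP.<⇒≤ a<b)
        | <ᵇ-false {b} {c} (NP.<⇒≤ (NP.<-trans c<a a<b)) | <ᵇ-true (NP.<-trans c<a a<b)
        | <ᵇ-true c<a = _

contains312⁻ : ∀ σ → T (contains p312 σ) → Occurs Is312 σ
contains312⁻ σ t with contains⁻ p312 σ t
... | a ∷ b ∷ c ∷ [] , abc⊆σ , iso with orderIso312⁻ a b c iso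
...   | b<c , c<a = a , b , c , (NP.<ᵇ⇒< b c b<c , NP.<ᵇ⇒< c a c<a) , abc⊆σ

contains312⁺ : ∀ σ → Occurs Is312 σ → T (contains p312 σ)
contains312⁺ σ (_ , _ , _ , r , abc⊆σ) = contains⁺ p312 σ abc⊆σ (orderIso312⁺ r)

contains231⁻ : ∀ σ → T (contains p231 σ) → Occurs Is231 σ
contains231⁻ σ t with contains⁻ p231 σ t
... | a ∷ b ∷ c ∷ [] , abc⊆σ , iso with orderIso231⁻ a b c iso
...   | c<a , a<b = a , b , c , (NP.<ᵇ⇒< c a c<a , NP.<ᵇ⇒< a b a<b) , abc⊆σ

contains231⁺ : ∀ σ → Occurs Is231 σ → T (contains p231 σ)
contains231⁺ σ (_ , _ , _ , r , abc⊆σ) = contains⁺ p231 σ abc⊆σ (orderIso231⁺ r)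

DoubleDescent NoDD : List ℕ → Set
DoubleDescent σ = T (hasDoubleDescent σ)
NoDD σ = ¬ DoubleDescent σ

DescentAt : ℕ → List ℕ → Set
DescentAt x σ = ∃ λ b → ∃ λ c → ∃ λ rest → σ ≡ b ∷ c ∷ rest × b < x × c < b

dd-head : ∀ {a b c} rest → b < a → c < b → DoubleDescent (a ∷ b ∷ c ∷ rest)
dd-head {b = b} {c} rest b<a c<b =
  T∨ˡ (hasDoubleDescent (b ∷ c ∷ rest)) (T∧⁺ (NP.<⇒<ᵇ b<a) (NP.<⇒<ᵇ c<b))

dd-∷ : ∀ x σ → DoubleDescent σ → DoubleDescent (x ∷ σ)
dd-∷ x (b ∷ c ∷ rest) dd = T∨ʳ _ dd

dd-∷⁻ : ∀ x σ → DoubleDescent (x ∷ σ) → DescentAt x σ ⊎ DoubleDescent σ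
dd-∷⁻ x (b ∷ c ∷ rest) dd with T∨⁻ ((b <ᵇ x) ∧ (c <ᵇ b)) dd
... | inj₂ dd′ = inj₂ dd′
... | inj₁ desc with T∧⁻ (b <ᵇ x) desc
...   | b<x , c<b = inj₁ (b , c , rest , refl , NP.<ᵇ⇒< b x b<x , NP.<ᵇ⇒< c b c<b)

dd⇒Occurs321 : ∀ σ → DoubleDescent σ → Occurs Is321 σ
dd⇒Occurs321 (a ∷ σ) dd with dd-∷⁻ a σ dd
... | inj₁ (b , c , rest , refl , b<a , c<b) = a , b , c , (b<a , c<b) , refl ∷ refl ∷ refl ∷ minimum rest
... | inj₂ dd′ = Occurs-⊆ (a ∷ʳ ⊆-refl) (dd⇒Occurs321 σ dd′)

dd-++ˡ : ∀ xs ys → DoubleDescent xs → DoubleDescent (xs ++ ys)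
dd-++ˡ (a ∷ xs) ys dd with dd-∷⁻ a xs dd
... | inj₁ (b , c , rest , refl , b<a , c<b) = dd-head (rest ++ ys) b<a c<b
... | inj₂ dd′ = dd-∷ a (xs ++ ys) (dd-++ˡ xs ys dd′)

dd-++ʳ : ∀ xs ys → DoubleDescent ys → DoubleDescent (xs ++ ys)
dd-++ʳ [] ys dd = dd
dd-++ʳ (x ∷ xs) ys dd = dd-∷ x (xs ++ ys) (dd-++ʳ xs ys dd)

dd-short : ∀ m ys → length ys ≤ 1 → NoDD (m ∷ ys)
dd-short m [] _ ()
dd-short m (y ∷ []) _ ()
dd-short m (y ∷ z ∷ _) (s≤s ())

-- If every letter of xs is below m, a double descent of xs m ys lies inside xs
-- or starts at m (m can be neither the middle nor the end of a descent).
dd-split : ∀ {m} xs ys → All (_< m) xs → DoubleDescent (xs ++ m ∷ ys) →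
           DoubleDescent xs ⊎ DoubleDescent (m ∷ ys)
dd-split [] ys _ dd = inj₂ dd
dd-split {m} (x ∷ xs) ys (x<m ∷ xs<m) dd with dd-∷⁻ x (xs ++ m ∷ ys) dd
... | inj₂ dd′ = map₁ (dd-∷ x xs) (dd-split xs ys xs<m dd′)
... | inj₁ (b , c , rest , eq , b<x , c<b) = inj₁ (descent-in-xs xs xs<m eq)
  where
  descent-in-xs : ∀ xs → All (_< m) xs → xs ++ m ∷ ys ≡ b ∷ c ∷ rest → DoubleDescent (x ∷ xs)
  descent-in-xs [] _ refl = ⊥-elim (NP.<-asym x<m b<x)
  descent-in-xs (_ ∷ []) (b<m ∷ _) refl = ⊥-elim (NP.<-asym b<m c<b)
  descent-in-xs (_ ∷ _ ∷ rest′) _ refl = dd-head rest′ b<x c<b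

restrict-++ : ∀ k xs ys → restrictTo k (xs ++ ys) ≡ restrictTo k xs ++ restrictTo k ys
restrict-++ k = LP.filter-++ (T? ∘ λ x → x <ᵇ suc k)

restrict-all : ∀ k {xs} → All (_≤ k) xs → restrictTo k xs ≡ xs
restrict-all k xs≤k = LP.filter-all (T? ∘ λ x → x <ᵇ suc k) (All.map (NP.<⇒<ᵇ ∘ s≤s) xs≤k)

restrict-⊆ : ∀ k σ → restrictTo k σ ⊆ σ
restrict-⊆ k σ = filter-⊆ (T? ∘ λ x → x <ᵇ suc k) σ

restrict-restrict : ∀ {k n} σ → k ≤ n → restrictTo k (restrictTo n σ) ≡ restrictTo k σ
restrict-restrict [] _ = refl
restrict-restrict {k} {n} (x ∷ σ) k≤n with x <ᵇ suc n in x≤n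
... | true with x <ᵇ suc k
...   | true  = cong (x ∷_) (restrict-restrict σ k≤n)
...   | false = restrict-restrict σ k≤n
restrict-restrict {k} {n} (x ∷ σ) k≤n | false with x <ᵇ suc k in x≤k
...   | false = restrict-restrict σ k≤n
...   | true  = ⊥-elim (subst T x≤n (NP.<⇒<ᵇ (NP.≤-trans x<k+1 (s≤s k≤n))))
  where x<k+1 = NP.<ᵇ⇒< x (suc k) (subst T (sym x≤k) _)

restrict-middle : ∀ n xs ys → All (_≤ n) (xs ++ ys) → restrictTo n (xs ++ suc n ∷ ys) ≡ xs ++ ys
restrict-middle n xs ys ≤n = begin
  restrictTo n (xs ++ suc n ∷ ys)            ≡⟨ restrict-++ n xs (suc n ∷ ys) ⟩
  restrictTo n xs ++ restrictTo n (suc n ∷ ys) ≡⟨ cong (restrictTo n xs ++_) drop-n+1 ⟩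
  restrictTo n xs ++ restrictTo n ys          ≡⟨ sym (restrict-++ n xs ys) ⟩
  restrictTo n (xs ++ ys)                    ≡⟨ restrict-all n ≤n ⟩
  xs ++ ys                                   ∎
  where
  open ≡-Reasoning
  drop-n+1 : restrictTo n (suc n ∷ ys) ≡ restrictTo n ys
  drop-n+1 = LP.filter-reject (T? ∘ λ x → x <ᵇ suc n) {x = suc n} {xs = ys} (NP.<-irrefl refl ∘ NP.<ᵇ⇒< (suc n) (suc n))

Simsun : ℕ → List ℕ → Set
Simsun n σ = ∀ {k} → InRange n k → NoDD (restrictTo k σ)

simsun⁻ : ∀ n σ → T (isSimsun n σ) → Simsun n σ
simsun⁻ n σ t k∈[n] =
  T-not⁻ (All.lookup (all⁺ (λ k → not (hasDoubleDescent (restrictTo k σ))) (range1 n) t) (range1-∈⁺ k∈[n]))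

simsun⁺ : ∀ n σ → Simsun n σ → T (isSimsun n σ)
simsun⁺ n σ s = all⁻ (λ k → not (hasDoubleDescent (restrictTo k σ))) (All.tabulate (T-not⁺ ∘ s ∘ range1-∈⁻))

-- A word over [n+1] is simsun iff its restriction to [n] is simsun and it has
-- no double descent itself (the restriction to [n+1] is the word).
simsun-step⁻ : ∀ {n σ} → All (_≤ suc n) σ → Simsun (suc n) σ →
               Simsun n (restrictTo n σ) × NoDD σ
simsun-step⁻ {n} {σ} ≤n+1 s =
  (λ {k} (1≤k , k≤n) → subst NoDD (sym (restrict-restrict σ k≤n)) (s (1≤k , NP.m≤n⇒m≤1+n k≤n))) ,
  subst NoDD (restrict-all (suc n) ≤n+1) (s (s≤s z≤n , NP.≤-refl))

simsun-step⁺ : ∀ {n σ} → All (_≤ suc n) σ → Simsun n (restrictTo n σ) → NoDD σ →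
               Simsun (suc n) σ
simsun-step⁺ {n} {σ} ≤n+1 s no-dd {k} (1≤k , k≤n+1) with NP.m≤n⇒m<n∨m≡n k≤n+1
... | inj₁ k<n+1 = subst NoDD (restrict-restrict σ (NP.≤-pred k<n+1)) (s (1≤k , NP.≤-pred k<n+1))
... | inj₂ refl = subst NoDD (sym (restrict-all (suc n) ≤n+1)) no-dd

-- A simsun permutation has no double descent (take k = n).
simsun⇒no-dd : ∀ {n σ} → IsPerm n σ → Simsun n σ → NoDD σ
simsun⇒no-dd {zero} {[]} _ _ ()
simsun⇒no-dd {suc n} p s =
  subst NoDD (restrict-all (suc n) (IsPerm⇒≤ p)) (s (s≤s z≤n , NP.≤-refl))

-- Every 321-avoiding word is simsun: a double descent is a 321-pattern.
avoid321⇒simsun : ∀ n σ → ¬ Occurs Is321 σ → Simsun n σ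
avoid321⇒simsun n σ avoid {k} _ dd = avoid (Occurs-⊆ (restrict-⊆ k σ) (dd⇒Occurs321 _ dd))

⊆-split : ∀ {A : Set} {s : List A} xs {m ys} → s ⊆ xs ++ m ∷ ys →
          s ⊆ xs ++ ys ⊎ ∃₂ λ s₁ s₂ → s ≡ s₁ ++ m ∷ s₂ × s₂ ⊆ ys
⊆-split [] (_ ∷ʳ s⊆ys) = inj₁ s⊆ys
⊆-split [] (refl ∷ s⊆ys) = inj₂ ([] , _ , refl , s⊆ys)
⊆-split (x ∷ xs) (.x ∷ʳ s⊆) = map₁ (x ∷ʳ_) (⊆-split xs s⊆)
⊆-split (x ∷ xs) (refl ∷ s⊆) with ⊆-split xs s⊆
... | inj₁ s⊆′ = inj₁ (refl ∷ s⊆′)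
... | inj₂ (s₁ , s₂ , refl , s₂⊆ys) = inj₂ (x ∷ s₁ , s₂ , refl , s₂⊆ys)

MaxFirst : Pattern → Set
MaxFirst R = ∀ {a b c} → R a b c → b < a × c < a

312-max-first : MaxFirst Is312
312-max-first (b<c , c<a) = NP.<-trans b<c c<a , c<a

321-max-first : MaxFirst Is321
321-max-first (b<a , c<b) = b<a , NP.<-trans c<b b<a

occurs-delete-max : ∀ {R m} xs ys → MaxFirst R → All (_≤ m) (xs ++ m ∷ ys) → length ys ≤ 1 →
                    Occurs R (xs ++ m ∷ ys) → Occurs R (xs ++ ys)
occurs-delete-max {m = m} xs ys max-first ≤m ys≤1 (a , b , c , r , abc⊆) with ⊆-split xs abc⊆
... | inj₁ abc⊆′ = a , b , c , r , abc⊆′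
... | inj₂ (s₁ , s₂ , abc≡ , s₂⊆ys) = ⊥-elim (uses-m s₁ abc≡)
  where
  a≤m : a ≤ m
  a≤m = All.lookup ≤m (Any-resp-⊆ abc⊆ (here refl))
  uses-m : ∀ s₁ → a ∷ b ∷ c ∷ [] ≡ s₁ ++ m ∷ s₂ → ⊥
  uses-m [] refl = NP.<⇒≱ (s≤s (s≤s z≤n)) (NP.≤-trans (length-mono-≤ s₂⊆ys) ys≤1)
  uses-m (_ ∷ []) refl = NP.<⇒≱ (proj₁ (max-first r)) a≤m
  uses-m (_ ∷ _ ∷ []) refl = NP.<⇒≱ (proj₂ (max-first r)) a≤m
  uses-m (_ ∷ _ ∷ _ ∷ []) ()
  uses-m (_ ∷ _ ∷ _ ∷ _ ∷ _) ()

occurs-insert : ∀ {R m} xs ys → Occurs R (xs ++ ys) → Occurs R (xs ++ m ∷ ys)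
occurs-insert {m = m} xs ys = Occurs-⊆ (++⁺ (⊆-refl {x = xs}) (m ∷ʳ ⊆-refl))

record InRS312 (n : ℕ) (σ : List ℕ) : Set where
  constructor rs312
  field
    isPerm    : IsPerm n σ
    simsun    : Simsun n σ
    avoids312 : ¬ Occurs Is312 σ
open InRS312

RS312-∈⁻ : ∀ n {σ} → σ ∈ RS n p312 → InRS312 n σ
RS312-∈⁻ n {σ} σ∈ with ∈-filterᵇ⁻ (λ σ → isSimsun n σ ∧ avoids p312 σ) (Sym n) σ∈
... | σ∈Sym , t with T∧⁻ (isSimsun n σ) t
...   | s , a = rs312 (Sym-∈⁻ n σ∈Sym) (simsun⁻ n σ s) (T-not⁻ a ∘ contains312⁺ σ)

RS312-∈⁺ : ∀ n {σ} → InRS312 n σ → σ ∈ RS n p312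
RS312-∈⁺ n {σ} (rs312 p s a) =
  ∈-filterᵇ⁺ (λ σ → isSimsun n σ ∧ avoids p312 σ) (Sym n) (Sym-∈⁺ n p)
    (T∧⁺ (simsun⁺ n σ s) (T-not⁺ (a ∘ contains312⁻ σ)))

RS312-unique : ∀ n → Unique (RS n p312)
RS312-unique n = UP.filter⁺ _ (Sym-unique n)

-- In σ ∈ RSₙ₊₁(312) the letter n+1 is followed by at most one letter: two
-- letters y₁ y₂ after it would form a 312 if y₁ < y₂ and a double descent
-- if y₁ > y₂.
RS312-max-near-end : ∀ n xs ys → InRS312 (suc n) (xs ++ suc n ∷ ys) → length ys ≤ 1
RS312-max-near-end n xs [] _ = z≤n
RS312-max-near-end n xs (_ ∷ []) _ = s≤s z≤n
RS312-max-near-end n xs (y₁ ∷ y₂ ∷ rest) (rs312 p s a) = ⊥-elim (by-comparison (NP.<-cmp y₁ y₂))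
  where
  p′ : IsPerm n (xs ++ y₁ ∷ y₂ ∷ rest)
  p′ = perm-delete xs _ p
  ≤n : ∀ {y} → y ∈ y₁ ∷ y₂ ∷ rest → y ≤ n
  ≤n y∈ = All.lookup (IsPerm⇒≤ p′) (MP.∈-++⁺ʳ xs y∈)
  by-comparison : Tri (y₁ < y₂) (y₁ ≡ y₂) (y₂ < y₁) → ⊥
  by-comparison (tri< y₁<y₂ _ _) =
    a (suc n , y₁ , y₂ , (y₁<y₂ , s≤s (≤n (there (here refl)))) , ++⁺ˡ xs (refl ∷ refl ∷ refl ∷ minimum rest))
  by-comparison (tri≈ _ refl _) = proj₂ (unique-delete xs (unique p′)) (∈-middle xs)
  by-comparison (tri> _ _ y₂<y₁) = simsun⇒no-dd p s (dd-++ʳ xs _ (dd-head rest (s≤s (≤n (here refl))) y₂<y₁))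

RS312-delete : ∀ n σ → InRS312 (suc n) σ →
  ∃₂ λ xs ys → σ ≡ xs ++ suc n ∷ ys × length ys ≤ 1 × InRS312 n (xs ++ ys)
RS312-delete n σ rs@(rs312 p s a) with perm-split p
... | xs , ys , refl = xs , ys , refl , RS312-max-near-end n xs ys rs , rs312 p′ s′ (a ∘ occurs-insert xs ys)
  where
  p′ : IsPerm n (xs ++ ys)
  p′ = perm-delete xs ys p
  s′ : Simsun n (xs ++ ys)
  s′ = subst (Simsun n) (restrict-middle n xs ys (IsPerm⇒≤ p′)) (proj₁ (simsun-step⁻ (IsPerm⇒≤ p) s))

RS312-insert : ∀ n xs ys → InRS312 n (xs ++ ys) → length ys ≤ 1 → InRS312 (suc n) (xs ++ suc n ∷ ys)
RS312-insert n xs ys (rs312 p s a) ys≤1 =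
  rs312 (perm-insert xs ys p)
        (simsun-step⁺ ≤n+1 (subst (Simsun n) (sym (restrict-middle n xs ys ≤n)) s) no-dd)
        (a ∘ occurs-delete-max xs ys 312-max-first ≤n+1 ys≤1)
  where
  ≤n : All (_≤ n) (xs ++ ys)
  ≤n = IsPerm⇒≤ p
  ≤n+1 : All (_≤ suc n) (xs ++ suc n ∷ ys)
  ≤n+1 = IsPerm⇒≤ (perm-insert xs ys p)
  no-dd : NoDD (xs ++ suc n ∷ ys)
  no-dd dd with dd-split xs ys (All.map s≤s (++⁻ˡ xs ≤n)) dd
  ... | inj₁ dd-xs = simsun⇒no-dd p s (dd-++ˡ xs ys dd-xs)
  ... | inj₂ dd-n+1 = dd-short (suc n) ys ys≤1 dd-n+1

-- Every element of RSₙ(312) avoids 321: by induction on n, an occurrence of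
-- 321 cannot use the largest letter n+1 (followed by at most one letter).
RS312-avoids321 : ∀ n σ → InRS312 n σ → ¬ Occurs Is321 σ
RS312-avoids321 zero σ (rs312 p _ _) (_ , _ , _ , _ , abc⊆σ) =
  NP.<⇒≱ (s≤s z≤n) (NP.≤-trans (length-mono-≤ abc⊆σ) (NP.≤-reflexive (length≡ p)))
RS312-avoids321 (suc n) σ rs occ with RS312-delete n σ rs
... | xs , ys , refl , ys≤1 , rs′ =
  RS312-avoids321 n (xs ++ ys) rs′
    (occurs-delete-max xs ys 321-max-first (IsPerm⇒≤ (isPerm rs)) ys≤1 occ)

insertBeforeLast : ℕ → List ℕ → List ℕ
insertBeforeLast m [] = [ m ]
insertBeforeLast m (y ∷ []) = m ∷ y ∷ []
insertBeforeLast m (x ∷ y ∷ rest) = x ∷ insertBeforeLast m (y ∷ rest)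

insertBeforeLast-∷ʳ : ∀ m xs y → insertBeforeLast m (xs ++ [ y ]) ≡ xs ++ m ∷ y ∷ []
insertBeforeLast-∷ʳ m [] y = refl
insertBeforeLast-∷ʳ m (x ∷ []) y = refl
insertBeforeLast-∷ʳ m (x ∷ x′ ∷ xs) y = cong (x ∷_) (insertBeforeLast-∷ʳ m (x′ ∷ xs) y)

extensions : ℕ → List ℕ → List (List ℕ)
extensions m τ = (τ ++ [ m ]) ∷ insertBeforeLast m τ ∷ []

length-extensions : ∀ m τs → length (concatMap (extensions m) τs) ≡ 2 * length τs
length-extensions m [] = refl
length-extensions m (τ ∷ τs) = trans (cong (suc ∘ suc) (length-extensions m τs)) (sym (NP.*-distribˡ-+ 2 1 (length τs)))

-- RSₙ₊₁(312) consists exactly of the extensions of the elements of RSₙ(312)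
-- (for n ≥ 1, so that every τ has a last letter).
RS312-succ-∈⁻ : ∀ n {σ} → σ ∈ RS (suc n) p312 → σ ∈ concatMap (extensions (suc n)) (RS n p312)
RS312-succ-∈⁻ n {σ} σ∈ with RS312-delete n σ (RS312-∈⁻ (suc n) σ∈)
... | xs , [] , refl , _ , rs =
  MP.∈-concatMap⁺ (extensions (suc n)) {xs = RS n p312}
    (Any.map (λ { refl → here (cong (_++ [ suc n ]) (sym (LP.++-identityʳ xs))) }) (RS312-∈⁺ n rs))
... | xs , y ∷ [] , refl , _ , rs =
  MP.∈-concatMap⁺ (extensions (suc n)) {xs = RS n p312}
    (Any.map (λ { refl → there (here (sym (insertBeforeLast-∷ʳ (suc n) xs y))) }) (RS312-∈⁺ n rs))
... | _ , _ ∷ _ ∷ _ , _ , s≤s () , _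

RS312-succ-∈⁺ : ∀ n {σ} → 1 ≤ n → σ ∈ concatMap (extensions (suc n)) (RS n p312) → σ ∈ RS (suc n) p312
RS312-succ-∈⁺ n 1≤n σ∈ with find (MP.∈-concatMap⁻ (extensions (suc n)) {xs = RS n p312} σ∈)
... | τ , τ∈ , here refl =
  RS312-∈⁺ (suc n) (RS312-insert n τ [] (subst (InRS312 n) (sym (LP.++-identityʳ τ)) (RS312-∈⁻ n τ∈)) z≤n)
... | τ , τ∈ , there (here refl) with initLast τ | RS312-∈⁻ n τ∈
...   | [] | rs = ⊥-elim (NP.<⇒≱ 1≤n (NP.≤-reflexive (sym (length≡ (isPerm rs)))))
...   | xs ∷ʳ′ y | rs rewrite insertBeforeLast-∷ʳ (suc n) xs y =
  RS312-∈⁺ (suc n) (RS312-insert n xs (y ∷ []) rs (s≤s z≤n))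

-- The two extensions of a nonempty τ over [n] differ (the last letters are
-- n+1 and a letter ≤ n), and deleting n+1 recovers τ from either.
extensions-unique : ∀ n τ → 1 ≤ n → InRS312 n τ → Unique (extensions (suc n) τ)
extensions-unique n τ 1≤n rs with initLast τ
... | [] = ⊥-elim (NP.<⇒≱ 1≤n (NP.≤-reflexive (sym (length≡ (isPerm rs)))))
... | xs ∷ʳ′ y = (different ∷ []) ∷ [] ∷ []
  where
  y≤n : y ≤ n
  y≤n = All.lookup (IsPerm⇒≤ (isPerm rs)) (MP.∈-++⁺ʳ xs (here refl))
  different : (xs ++ [ y ]) ++ [ suc n ] ≢ insertBeforeLast (suc n) (xs ++ [ y ])
  different eq rewrite insertBeforeLast-∷ʳ (suc n) xs y | LP.++-assoc xs [ y ] [ suc n ] =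
    NP.<-irrefl (LP.∷-injectiveˡ (LP.++-cancelˡ xs _ _ eq)) (s≤s y≤n)

extensions-retract : ∀ n τ → InRS312 n τ → ∀ {σ} → σ ∈ extensions (suc n) τ → restrictTo n σ ≡ τ
extensions-retract n τ rs (here refl) =
  trans (restrict-middle n τ [] (subst (All (_≤ n)) (sym (LP.++-identityʳ τ)) (IsPerm⇒≤ (isPerm rs))))
        (LP.++-identityʳ τ)
extensions-retract n τ rs (there (here refl)) with initLast τ
... | [] = restrict-middle n [] [] []
... | xs ∷ʳ′ y rewrite insertBeforeLast-∷ʳ (suc n) xs y = restrict-middle n xs [ y ] (IsPerm⇒≤ (isPerm rs))

RS312-double : ∀ n → 1 ≤ n → length (RS (suc n) p312) ≡ 2 * length (RS n p312)
RS312-double n 1≤n = begin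
  length (RS (suc n) p312)                          ≡⟨ same-length (RS312-unique (suc n)) unique-extensions
                                                         (RS312-succ-∈⁻ n) (RS312-succ-∈⁺ n 1≤n) ⟩
  length (concatMap (extensions (suc n)) (RS n p312)) ≡⟨ length-extensions (suc n) (RS n p312) ⟩
  2 * length (RS n p312)                            ∎
  where
  open ≡-Reasoning
  unique-extensions : Unique (concatMap (extensions (suc n)) (RS n p312))
  unique-extensions =
    unique-concatMap (extensions (suc n)) (restrictTo n) (RS312-unique n)
      (λ τ∈ → extensions-unique n _ 1≤n (RS312-∈⁻ n τ∈))
      (λ τ∈ → extensions-retract n _ (RS312-∈⁻ n τ∈))

RS312-count : ∀ k → length (RS (suc k) p312) ≡ 2 ^ k
RS312-count zero = refl
RS312-count (suc k) = trans (RS312-double (suc k) (s≤s z≤n)) (cong (2 *_) (RS312-count k))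

-- Positions.  At σ i v: the letter of σ at (0-based) index i is v.

data At : List ℕ → ℕ → ℕ → Set where
  here  : ∀ {x xs} → At (x ∷ xs) 0 x
  there : ∀ {y xs i v} → At xs i v → At (y ∷ xs) (suc i) v

At-functional : ∀ {σ i v w} → At σ i v → At σ i w → v ≡ w
At-functional here here = refl
At-functional (there p) (there q) = At-functional p q

At⇒< : ∀ {σ i v} → At σ i v → i < length σ
At⇒< here = s≤s z≤n
At⇒< (there p) = s≤s (At⇒< p)

∈⇒At : ∀ {σ v} → v ∈ σ → ∃ λ i → At σ i v
∈⇒At (here refl) = 0 , here
∈⇒At (there v∈) = let i , p = ∈⇒At v∈ in suc i , there p

At⇒∈ : ∀ {σ i v} → At σ i v → v ∈ σ
At⇒∈ here = here refl
At⇒∈ (there p) = there (At⇒∈ p)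

Positions : List ℕ → ℕ → ℕ → ℕ → Set
Positions σ a b c = ∃ λ i → ∃ λ j → ∃ λ k → i < j × j < k × At σ i a × At σ j b × At σ k c

⊆⇒At₁ : ∀ {σ c} → [ c ] ⊆ σ → ∃ λ k → At σ k c
⊆⇒At₁ (_ ∷ʳ c⊆) = let k , pc = ⊆⇒At₁ c⊆ in suc k , there pc
⊆⇒At₁ (refl ∷ _) = 0 , here

⊆⇒At₂ : ∀ {σ b c} → (b ∷ c ∷ []) ⊆ σ → ∃ λ j → ∃ λ k → j < k × At σ j b × At σ k c
⊆⇒At₂ (_ ∷ʳ bc⊆) = let j , k , j<k , pb , pc = ⊆⇒At₂ bc⊆ in suc j , suc k , s≤s j<k , there pb , there pc
⊆⇒At₂ (refl ∷ c⊆) = let k , pc = ⊆⇒At₁ c⊆ in 0 , suc k , s≤s z≤n , here , there pc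

⊆⇒Positions : ∀ {σ a b c} → (a ∷ b ∷ c ∷ []) ⊆ σ → Positions σ a b c
⊆⇒Positions (_ ∷ʳ abc⊆) = let i , j , k , i<j , j<k , pa , pb , pc = ⊆⇒Positions abc⊆ in
  suc i , suc j , suc k , s≤s i<j , s≤s j<k , there pa , there pb , there pc
⊆⇒Positions (refl ∷ bc⊆) = let j , k , j<k , pb , pc = ⊆⇒At₂ bc⊆ in
  0 , suc j , suc k , s≤s z≤n , s≤s j<k , here , there pb , there pc

At⇒⊆₁ : ∀ {σ k c} → At σ k c → [ c ] ⊆ σ
At⇒⊆₁ {_ ∷ σ} here = refl ∷ minimum σ
At⇒⊆₁ (there pc) = _ ∷ʳ At⇒⊆₁ pc

At⇒⊆₂ : ∀ {σ j k b c} → j < k → At σ j b → At σ k c → (b ∷ c ∷ []) ⊆ σ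
At⇒⊆₂ _ here (there pc) = refl ∷ At⇒⊆₁ pc
At⇒⊆₂ (s≤s j<k) (there pb) (there pc) = _ ∷ʳ At⇒⊆₂ j<k pb pc

Positions⇒⊆ : ∀ {σ a b c} → Positions σ a b c → (a ∷ b ∷ c ∷ []) ⊆ σ
Positions⇒⊆ (0 , suc j , suc k , _ , s≤s j<k , here , there pb , there pc) = refl ∷ At⇒⊆₂ j<k pb pc
Positions⇒⊆ (suc i , suc j , suc k , s≤s i<j , s≤s j<k , there pa , there pb , there pc) =
  _ ∷ʳ Positions⇒⊆ (i , j , k , i<j , j<k , pa , pb , pc)

-- The inverse permutation.  inverse n σ lists position v σ for v = 1,…,n, so
-- σ has v+1 at index i iff σ⁻¹ has i+1 at index v.

position-At : ∀ {σ i v} → Unique σ → At σ i v → position v σ ≡ suc i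
position-At {v = v} _ here with v ≡ᵇ v | NP.≡⇒≡ᵇ v v refl
... | true | _ = refl
position-At {x ∷ σ} {v = v} (x∉σ ∷ u) (there p) with v ≡ᵇ x in v≟x
... | false = cong suc (position-At u p)
... | true = ⊥-elim (All.lookup x∉σ (At⇒∈ p) (sym (NP.≡ᵇ⇒≡ v x (subst T (sym v≟x) _))))

At-map-applyUpTo⁻ : ∀ (f g : ℕ → ℕ) n {i w} → At (map f (applyUpTo g n)) i w → i < n × w ≡ f (g i)
At-map-applyUpTo⁻ f g (suc n) here = s≤s z≤n , refl
At-map-applyUpTo⁻ f g (suc n) (there p) =
  let i<n , w≡ = At-map-applyUpTo⁻ f (g ∘ suc) n p in s≤s i<n , w≡

At-map-applyUpTo⁺ : ∀ (f g : ℕ → ℕ) n {i} → i < n → At (map f (applyUpTo g n)) i (f (g i))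
At-map-applyUpTo⁺ f g (suc n) {zero} _ = here
At-map-applyUpTo⁺ f g (suc n) {suc i} (s≤s i<n) = there (At-map-applyUpTo⁺ f (g ∘ suc) n i<n)

inverse-At⁺ : ∀ {n σ i v} → IsPerm n σ → At σ i v → ∃ λ v′ → v ≡ suc v′ × At (inverse n σ) v′ (suc i)
inverse-At⁺ {v = zero} p pv with () ← proj₁ (All.lookup (inRange p) (At⇒∈ pv))
inverse-At⁺ {n} {σ} {v = suc v′} p pv with _ , v≤n ← All.lookup (inRange p) (At⇒∈ pv) =
  v′ , refl , subst (At (inverse n σ) v′) (position-At (unique p) pv) (At-map-applyUpTo⁺ (λ w → position w σ) suc n v≤n)

inverse-At⁻ : ∀ {n σ j w} → IsPerm n σ → At (inverse n σ) j w → ∃ λ i → w ≡ suc i × At σ i (suc j)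
inverse-At⁻ {n} {σ} p pw with At-map-applyUpTo⁻ (λ w → position w σ) suc n pw
... | j<n , refl with ∈⇒At (perm-surjective p (s≤s z≤n , j<n))
...   | i , pi = i , position-At (unique p) pi , pi

-- Inversion exchanges the roles of positions and values, so it turns a 231
-- into a 312 (and back), and a 321 into a 321.

231⇒inverse-312 : ∀ {n σ} → IsPerm n σ → Occurs Is231 σ → Occurs Is312 (inverse n σ)
231⇒inverse-312 p (a , b , c , (c<a , a<b) , abc⊆σ) with ⊆⇒Positions abc⊆σ
... | i , j , k , i<j , j<k , pa , pb , pc with inverse-At⁺ p pa | inverse-At⁺ p pb | inverse-At⁺ p pc
...   | a′ , refl , pa′ | b′ , refl , pb′ | c′ , refl , pc′ =
  suc k , suc i , suc j , (s≤s i<j , s≤s j<k) ,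
  Positions⇒⊆ (c′ , a′ , b′ , NP.≤-pred c<a , NP.≤-pred a<b , pc′ , pa′ , pb′)

inverse-312⇒231 : ∀ {n σ} → IsPerm n σ → Occurs Is312 (inverse n σ) → Occurs Is231 σ
inverse-312⇒231 p (x , y , z , (y<z , z<x) , xyz⊆) with ⊆⇒Positions xyz⊆
... | i , j , k , i<j , j<k , px , py , pz with inverse-At⁻ p px | inverse-At⁻ p py | inverse-At⁻ p pz
...   | x′ , refl , px′ | y′ , refl , py′ | z′ , refl , pz′ =
  suc j , suc k , suc i , (s≤s i<j , s≤s j<k) ,
  Positions⇒⊆ (y′ , z′ , x′ , NP.≤-pred y<z , NP.≤-pred z<x , py′ , pz′ , px′)

inverse-321⇒321 : ∀ {n σ} → IsPerm n σ → Occurs Is321 (inverse n σ) → Occurs Is321 σ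
inverse-321⇒321 p (x , y , z , (y<x , z<y) , xyz⊆) with ⊆⇒Positions xyz⊆
... | i , j , k , i<j , j<k , px , py , pz with inverse-At⁻ p px | inverse-At⁻ p py | inverse-At⁻ p pz
...   | x′ , refl , px′ | y′ , refl , py′ | z′ , refl , pz′ =
  suc k , suc j , suc i , (s≤s j<k , s≤s i<j) ,
  Positions⇒⊆ (z′ , y′ , x′ , NP.≤-pred z<y , NP.≤-pred y<x , pz′ , py′ , px′)

At-injective⇒unique : ∀ σ → (∀ {i j v} → At σ i v → At σ j v → i ≡ j) → Unique σ
At-injective⇒unique [] _ = []
At-injective⇒unique (x ∷ σ) inj =
  All.tabulate x≢ ∷ At-injective⇒unique σ (λ p q → NP.suc-injective (inj (there p) (there q)))
  where
  x≢ : ∀ {z} → z ∈ σ → x ≢ z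
  x≢ z∈σ refl with inj here (there (proj₂ (∈⇒At z∈σ)))
  ... | ()

At-extensional : ∀ σ τ → length σ ≡ length τ → (∀ {i v} → At σ i v → At τ i v) → σ ≡ τ
At-extensional [] [] _ _ = refl
At-extensional (x ∷ σ) (y ∷ τ) len same =
  cong₂ _∷_ (At-functional (same here) here)
            (At-extensional σ τ (NP.suc-injective len) (λ p → untail (same (there p))))
  where
  untail : ∀ {i v} → At (y ∷ τ) (suc i) v → At τ i v
  untail (there p) = p

inverse-perm : ∀ {n σ} → IsPerm n σ → IsPerm n (inverse n σ)
inverse-perm {n} {σ} p =
  perm (trans (LP.length-map (λ v → position v σ) (range1 n)) (LP.length-applyUpTo suc n))
       (All.tabulate in-range) (At-injective⇒unique _ injective)
  where
  in-range : ∀ {w} → w ∈ inverse n σ → InRange n w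
  in-range w∈ with inverse-At⁻ p (proj₂ (∈⇒At w∈))
  ... | i , refl , pi = s≤s z≤n , subst (suc i ≤_) (length≡ p) (At⇒< pi)
  injective : ∀ {i j v} → At (inverse n σ) i v → At (inverse n σ) j v → i ≡ j
  injective pi pj with inverse-At⁻ p pi | inverse-At⁻ p pj
  ... | _ , refl , qi | _ , v≡ , qj with NP.suc-injective v≡
  ...   | refl = NP.suc-injective (At-functional qi qj)

inverse-involutive : ∀ {n σ} → IsPerm n σ → inverse n (inverse n σ) ≡ σ
inverse-involutive {n} {σ} p =
  At-extensional _ σ (trans (length≡ (inverse-perm (inverse-perm p))) (sym (length≡ p))) same
  where
  same : ∀ {i v} → At (inverse n (inverse n σ)) i v → At σ i v
  same pv with inverse-At⁻ (inverse-perm p) pv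
  ... | _ , refl , pv′ with inverse-At⁻ p pv′
  ...   | _ , refl , pv″ = pv″

record InDRS (n : ℕ) (R : Pattern) (σ : List ℕ) : Set where
  constructor drs
  field
    isPerm         : IsPerm n σ
    simsun         : Simsun n σ
    avoidsPattern  : ¬ Occurs R σ
    inverse-simsun : Simsun n (inverse n σ)

DRS-∈⁻ : ∀ n ω R → (∀ σ → Occurs R σ → T (contains ω σ)) → ∀ {σ} → σ ∈ DRS n ω → InDRS n R σ
DRS-∈⁻ n ω R occurs⇒contains {σ} σ∈ with ∈-filterᵇ⁻ (λ σ → isSimsun n (inverse n σ)) (RS n ω) σ∈
... | σ∈RS , inv-s with ∈-filterᵇ⁻ (λ σ → isSimsun n σ ∧ avoids ω σ) (Sym n) σ∈RS
...   | σ∈Sym , t with T∧⁻ (isSimsun n σ) t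
...     | s , a = drs (Sym-∈⁻ n σ∈Sym) (simsun⁻ n σ s) (T-not⁻ a ∘ occurs⇒contains σ)
                      (simsun⁻ n (inverse n σ) inv-s)

DRS-∈⁺ : ∀ n ω R → (∀ σ → T (contains ω σ) → Occurs R σ) → ∀ {σ} → InDRS n R σ → σ ∈ DRS n ω
DRS-∈⁺ n ω R contains⇒occurs {σ} (drs p s a inv-s) =
  ∈-filterᵇ⁺ (λ σ → isSimsun n (inverse n σ)) (RS n ω)
    (∈-filterᵇ⁺ (λ σ → isSimsun n σ ∧ avoids ω σ) (Sym n) (Sym-∈⁺ n p)
      (T∧⁺ (simsun⁺ n σ s) (T-not⁺ (a ∘ contains⇒occurs σ))))
    (simsun⁺ n (inverse n σ) inv-s)

DRS-unique : ∀ n ω → Unique (DRS n ω)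
DRS-unique n ω = UP.filter⁺ _ (UP.filter⁺ _ (Sym-unique n))

-- DRSₙ(312) = RSₙ(312): elements of RSₙ(312) avoid 321, hence so do their
-- inverses, and 321-avoiding words are simsun.
DRS312≡RS312 : ∀ n → DRS n p312 ≡ RS n p312
DRS312≡RS312 n = LP.filter-all (T? ∘ λ σ → isSimsun n (inverse n σ)) (All.tabulate inverse-simsun)
  where
  inverse-simsun : ∀ {σ} → σ ∈ RS n p312 → T (isSimsun n (inverse n σ))
  inverse-simsun {σ} σ∈ =
    let rs = RS312-∈⁻ n σ∈ in
    simsun⁺ n (inverse n σ) (avoid321⇒simsun n (inverse n σ) (RS312-avoids321 n σ rs ∘ inverse-321⇒321 (isPerm rs)))

inverse-DRS231 : ∀ {n σ} → InDRS n Is231 σ → InDRS n Is312 (inverse n σ)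
inverse-DRS231 {n} (drs p s a inv-s) =
  drs (inverse-perm p) inv-s (a ∘ inverse-312⇒231 p) (subst (Simsun n) (sym (inverse-involutive p)) s)

inverse-DRS312 : ∀ {n σ} → InDRS n Is312 σ → InDRS n Is231 (inverse n σ)
inverse-DRS312 {n} (drs p s a inv-s) =
  drs (inverse-perm p) inv-s (a ∘ subst (Occurs Is312) (inverse-involutive p) ∘ 231⇒inverse-312 (inverse-perm p))
      (subst (Simsun n) (sym (inverse-involutive p)) s)

DRS231-count : ∀ n → length (DRS n p231) ≡ length (DRS n p312)
DRS231-count n = begin
  length (DRS n p231)               ≡⟨ sym (LP.length-map (inverse n) (DRS n p231)) ⟩
  length (map (inverse n) (DRS n p231)) ≡⟨ same-length (unique-map-on (inverse n) (DRS-unique n p231) injective)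
                                           (DRS-unique n p312) onto-312 from-312 ⟩
  length (DRS n p312)               ∎
  where
  open ≡-Reasoning
  ∈DRS231⁻ = DRS-∈⁻ n p231 Is231 contains231⁺
  injective : ∀ {σ τ} → σ ∈ DRS n p231 → τ ∈ DRS n p231 → inverse n σ ≡ inverse n τ → σ ≡ τ
  injective {σ} {τ} σ∈ τ∈ eq = begin
    σ                         ≡⟨ sym (inverse-involutive (InDRS.isPerm (∈DRS231⁻ σ∈))) ⟩
    inverse n (inverse n σ)   ≡⟨ cong (inverse n) eq ⟩
    inverse n (inverse n τ)   ≡⟨ inverse-involutive (InDRS.isPerm (∈DRS231⁻ τ∈)) ⟩
    τ                         ∎
  onto-312 : ∀ {τ} → τ ∈ map (inverse n) (DRS n p231) → τ ∈ DRS n p312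
  onto-312 τ∈ with MP.∈-map⁻ (inverse n) τ∈
  ... | σ , σ∈ , refl = DRS-∈⁺ n p312 Is312 contains312⁻ (inverse-DRS231 (∈DRS231⁻ σ∈))
  from-312 : ∀ {τ} → τ ∈ DRS n p312 → τ ∈ map (inverse n) (DRS n p231)
  from-312 τ∈ =
    let d = DRS-∈⁻ n p312 Is312 contains312⁺ τ∈ in
    subst (_∈ map (inverse n) (DRS n p231)) (inverse-involutive (InDRS.isPerm d))
      (MP.∈-map⁺ (inverse n) (DRS-∈⁺ n p231 Is231 contains231⁻ (inverse-DRS312 d)))

theorem4p5 : (n : ℕ) → 1 ≤ n →
    (length (DRS n p231) ≡ 2 ^ (n ∸ 1)) ×
    (length (DRS n p312) ≡ 2 ^ (n ∸ 1)) ×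
    (length (RS n p312) ≡ 2 ^ (n ∸ 1))
theorem4p5 (suc k) _ = trans (DRS231-count (suc k)) DRS312-count , DRS312-count , RS312-count k
  where
  DRS312-count : length (DRS (suc k) p312) ≡ 2 ^ k
  DRS312-count = trans (cong length (DRS312≡RS312 (suc k))) (RS312-count k)
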